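{- Let $A\in\mathbb{R}^{n\times n}$. Then $A$ is a Kleene star if and only if $A^t$ is a Kleene star. In that case $\operatorname{span}(A^t)=s(\operatorname{span}(A))$, where $s:\mathbb{R}^{n-1}\to\mathbb{R}^{n-1}$, $s(x)=-x$, is the antipodal map. In particular, if $A$ is a Kleene star, then $A$ is symmetric if and only if $\operatorname{span}(A)$ is symmetric with respect to the origin.
   Context: A matrix $A=(a_{ij})\in\mathbb{R}^{n\times n}$ is a Kleene star if $a_{ii}=0$ for all $i$ and $a_{ik}+a_{kj}\le a_{ij}$ for all $i,j,k\in[n]$. Tropical projective space $\mathbb{TP}^{n-1}=\mathbb{R}^n/\mathbb{R}(1,\dots,1)$ is identified with $\mathbb{R}^{n-1}$ by choosing representatives with last coordinate $0$. The tropical span of the columns $a_1,\dots,a_n$ of $A$ is $\operatorname{span}(A)=\{\max_k(\lambda_k+a_k):\lambda_1,\dots,\lambda_n\in\mathbb{R}\}\subseteq\mathbb{TP}^{n-1}$ (maximum taken coordinatewise), viewed as a subset of $\mathbb{R}^{n-1}$ via this identification. -}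

module Defs where

open import Data.Nat using (ℕ; zero; suc)
open import Data.Fin using (Fin; zero; suc; inject₁; fromℕ)
open import Data.Product using (Σ; ∃; _×_; _,_)
open import Relation.Nullary using (¬_)
open import Relation.Binary.PropositionalEquality using (_≡_)
open import Relation.Binary.Structures using (IsTotalOrder)
open import Algebra.Structures using (IsCommutativeRing)
open import Function.Bundles using (_⇔_)

-- An axiomatisation of the real numbers: a Dedekind-complete ordered field
-- (unique up to isomorphism), together with a binary max operation.
record RealField : Set₁ where
  infixl 6 _+_
  infixl 7 _*_
  infix 4 _≤_
  field
    Carrier : Set
    _+_ _*_ : Carrier → Carrier → Carrier
    -_      : Carrier → Carrier
    0# 1#   : Carrier
    _≤_     : Carrier → Carrier → Set
    isCommutativeRing : IsCommutativeRing _≡_ _+_ _*_ -_ 0# 1#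
    isTotalOrder      : IsTotalOrder _≡_ _≤_
    nontrivial        : ¬ (0# ≡ 1#)
    inverse           : ∀ x → ¬ (x ≡ 0#) → ∃ λ y → x * y ≡ 1#
    +-mono-≤          : ∀ {x y} z → x ≤ y → x + z ≤ y + z
    *-nonneg          : ∀ {x y} → 0# ≤ x → 0# ≤ y → 0# ≤ x * y
    complete : (P : Carrier → Set) → ∃ P → (∃ λ b → ∀ x → P x → x ≤ b) →
               ∃ λ s → (∀ x → P x → x ≤ s) × (∀ b → (∀ x → P x → x ≤ b) → s ≤ b)
    max     : Carrier → Carrier → Carrier
    max-r   : ∀ {x y} → x ≤ y → max x y ≡ y
    max-l   : ∀ {x y} → y ≤ x → max x y ≡ x

module _ (ℝ : RealField) where
  open RealField ℝ

  _-_ : Carrier → Carrier → Carrier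
  x - y = x + (- y)

  Matrix : ℕ → Set
  Matrix n = Fin n → Fin n → Carrier

  transpose : ∀ {n} → Matrix n → Matrix n
  transpose A i j = A j i

  IsKleeneStar : ∀ {n} → Matrix n → Set
  IsKleeneStar A = (∀ i → A i i ≡ 0#) × (∀ i j k → A i k + A k j ≤ A i j)

  IsSymmetric : ∀ {n} → Matrix n → Set
  IsSymmetric A = ∀ i j → A i j ≡ A j i

  maxF : ∀ {m} → (Fin (suc m) → Carrier) → Carrier
  maxF {zero}  f = f zero
  maxF {suc m} f = max (f zero) (maxF (λ k → f (suc k)))

  tropComb : ∀ {m} → Matrix (suc m) → (Fin (suc m) → Carrier) → Fin (suc m) → Carrier
  tropComb A lam i = maxF (λ k → lam k + A i k)

  -- span(A) ⊆ TP^{n-1} ≅ R^{n-1} (representative with last coordinate 0), n = suc m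
  InSpan : ∀ {m} → Matrix (suc m) → (Fin m → Carrier) → Set
  InSpan {m} A x = ∃ λ lam → ∀ i →
    x i ≡ tropComb A lam (inject₁ i) - tropComb A lam (fromℕ m)

  antipode : ∀ {m} → (Fin m → Carrier) → (Fin m → Carrier)
  antipode x i = - (x i)

  SpanSymmetric : ∀ {m} → Matrix (suc m) → Set
  SpanSymmetric {m} A = ∀ (x : Fin m → Carrier) → InSpan A x → InSpan A (antipode x)

-- For a Kleene star A the tropical column span, before projectivising, is exactly the set of
-- subeigenvectors z, those with z j + A i j ≤ z i for all i j: each tropical combination of columns
-- satisfies this by the triangle inequality, and conversely such a z is the combination of the columns
-- with coefficients z itself, as A i i = 0. Negating z turns the inequalities for Aᵗ into those for A,
-- so span(Aᵗ) = -span(A). If span(A) = -span(A), then row j of A, which lies in span(Aᵗ), lies in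
-- span(A) up to a constant shift, and its subeigenvector inequality at (i , j) reads A i j ≤ A j i.
module Submission where

open import Defs
open import Data.Nat using (ℕ; zero; suc)
open import Data.Fin using (Fin; zero; suc; inject₁; fromℕ)
open import Data.Fin.Relation.Unary.Top using (view; ‵fromℕ; ‵inject₁)
open import Data.Product using (∃; _×_; _,_; proj₁)
open import Data.Sum using (inj₁; inj₂)
open import Relation.Binary.PropositionalEquality
  using (_≡_; _≗_; refl; sym; trans; cong; cong₂; subst₂; module ≡-Reasoning)
open import Relation.Binary.Bundles using (Poset)
open import Relation.Binary.Structures using (IsTotalOrder)
import Relation.Binary.Reasoning.PartialOrder as PosetReasoning
open import Algebra.Bundles using (CommutativeRing)
open import Algebra.Structures using (IsCommutativeRing)
open import Function.Base using (_∘_)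
open import Function.Bundles using (_⇔_; mk⇔)

module KleeneStarSpan (ℝ : RealField) where
  open RealField ℝ
  open IsCommutativeRing isCommutativeRing using (+-assoc; +-comm; +-identityˡ; +-identityʳ)
  open IsTotalOrder isTotalOrder using (total; antisym; isPartialOrder)
    renaming (refl to ≤-refl; trans to ≤-trans)

  commutativeRing : CommutativeRing _ _
  commutativeRing = record { isCommutativeRing = isCommutativeRing }

  open CommutativeRing commutativeRing using (+-abelianGroup; +-commutativeSemigroup)
  open import Algebra.Properties.AbelianGroup +-abelianGroup
    using (⁻¹-involutive; ⁻¹-∙-comm; //-rightDividesˡ; //-rightDividesʳ; \\-leftDividesˡ; \\-leftDividesʳ)
  open import Algebra.Properties.CommutativeSemigroup +-commutativeSemigroup
    using (xy∙z≈xz∙y; xy∙z≈x∙zy; x∙yz≈x∙zy)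

  poset : Poset _ _ _
  poset = record { isPartialOrder = isPartialOrder }

  module ≤-Reasoning = PosetReasoning poset

  +-monoˡ-≤ : ∀ z {x y} → x ≤ y → z + x ≤ z + y
  +-monoˡ-≤ z {x} {y} x≤y = subst₂ _≤_ (+-comm x z) (+-comm y z) (+-mono-≤ z x≤y)

  x+a≤y⇒x≤y-a : ∀ {x a y} → x + a ≤ y → x ≤ y + - a
  x+a≤y⇒x≤y-a {x} {a} p = subst₂ _≤_ (//-rightDividesʳ a x) refl (+-mono-≤ (- a) p)

  x≤y-a⇒x+a≤y : ∀ {x a y} → x ≤ y + - a → x + a ≤ y
  x≤y-a⇒x+a≤y {a = a} {y} p = subst₂ _≤_ refl (//-rightDividesˡ a y) (+-mono-≤ a p)

  +-cancelʳ-≤ : ∀ d {x y} → x + d ≤ y + d → x ≤ y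
  +-cancelʳ-≤ d {x} {y} p = subst₂ _≤_ (//-rightDividesʳ d x) (//-rightDividesʳ d y) (+-mono-≤ (- d) p)

  a+x≤b⇒-b+x≤-a : ∀ {a x b} → a + x ≤ b → - b + x ≤ - a
  a+x≤b⇒-b+x≤-a {a} {x} {b} p = begin
    - b + x               ≡⟨ cong (- b +_) (\\-leftDividesʳ a x) ⟨
    - b + (- a + (a + x)) ≤⟨ +-monoˡ-≤ (- b) (+-monoˡ-≤ (- a) p) ⟩
    - b + (- a + b)       ≡⟨ x∙yz≈x∙zy (- b) (- a) b ⟩
    - b + (b + - a)       ≡⟨ \\-leftDividesʳ b (- a) ⟩
    - a                   ∎
    where open ≤-Reasoning

  x≤max[x,y] : ∀ x y → x ≤ max x y
  x≤max[x,y] x y with total x y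
  ... | inj₁ x≤y = subst₂ _≤_ refl (sym (max-r x≤y)) x≤y
  ... | inj₂ y≤x = subst₂ _≤_ refl (sym (max-l y≤x)) ≤-refl

  y≤max[x,y] : ∀ x y → y ≤ max x y
  y≤max[x,y] x y with total x y
  ... | inj₁ x≤y = subst₂ _≤_ refl (sym (max-r x≤y)) ≤-refl
  ... | inj₂ y≤x = subst₂ _≤_ refl (sym (max-l y≤x)) y≤x

  max-lub : ∀ {x y b} → x ≤ b → y ≤ b → max x y ≤ b
  max-lub {x} {y} x≤b y≤b with total x y
  ... | inj₁ x≤y = subst₂ _≤_ (sym (max-r x≤y)) refl y≤b
  ... | inj₂ y≤x = subst₂ _≤_ (sym (max-l y≤x)) refl x≤b

  f≤maxF : ∀ {m} (f : Fin (suc m) → Carrier) k → f k ≤ maxF ℝ f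
  f≤maxF {zero}  f zero    = ≤-refl
  f≤maxF {suc m} f zero    = x≤max[x,y] _ _
  f≤maxF {suc m} f (suc k) = ≤-trans (f≤maxF (λ k → f (suc k)) k) (y≤max[x,y] _ _)

  maxF-lub : ∀ {m} (f : Fin (suc m) → Carrier) {b} → (∀ k → f k ≤ b) → maxF ℝ f ≤ b
  maxF-lub {zero}  f f≤b = f≤b zero
  maxF-lub {suc m} f f≤b = max-lub (f≤b zero) (maxF-lub (λ k → f (suc k)) (λ k → f≤b (suc k)))

  IsSubeigenvector : ∀ {n} → Matrix ℝ n → (Fin n → Carrier) → Set
  IsSubeigenvector A z = ∀ i j → z j + A i j ≤ z i

  dehomogenise : ∀ {m} → (Fin (suc m) → Carrier) → Fin m → Carrier
  dehomogenise {m} z i = z (inject₁ i) + - z (fromℕ m)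

  antipode-involutive : ∀ {m} (x : Fin m → Carrier) → antipode ℝ (antipode ℝ x) ≗ x
  antipode-involutive x i = ⁻¹-involutive (x i)

  inSpan-resp : ∀ {m} (A : Matrix ℝ (suc m)) {x y} → x ≗ y → InSpan ℝ A x → InSpan ℝ A y
  inSpan-resp A x≗y (lam , x≡) = lam , λ i → trans (sym (x≗y i)) (x≡ i)

  module _ {m} {A : Matrix ℝ (suc m)} where

    transpose-isKleeneStar : IsKleeneStar ℝ A → IsKleeneStar ℝ (transpose ℝ A)
    transpose-isKleeneStar (diag , tri) = diag , λ i j k → subst₂ _≤_ (+-comm _ _) refl (tri j i k)

    column-isSubeigenvector : IsKleeneStar ℝ A → ∀ j → IsSubeigenvector A (λ k → A k j)
    column-isSubeigenvector (_ , tri) j i k = subst₂ _≤_ (+-comm _ _) refl (tri i j k)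

    tropComb-isSubeigenvector : IsKleeneStar ℝ A → ∀ lam → IsSubeigenvector A (tropComb ℝ A lam)
    tropComb-isSubeigenvector (_ , tri) lam i j =
      x≤y-a⇒x+a≤y (maxF-lub _ λ k → x+a≤y⇒x≤y-a (term≤ k))
      where
      open ≤-Reasoning
      term≤ : ∀ k → (lam k + A j k) + A i j ≤ tropComb ℝ A lam i
      term≤ k = begin
        (lam k + A j k) + A i j ≡⟨ xy∙z≈x∙zy (lam k) (A j k) (A i j) ⟩
        lam k + (A i j + A j k) ≤⟨ +-monoˡ-≤ (lam k) (tri i k j) ⟩
        lam k + A i k           ≤⟨ f≤maxF (λ k → lam k + A i k) k ⟩
        tropComb ℝ A lam i      ∎

    tropComb-fixesSubeigenvector : IsKleeneStar ℝ A → ∀ {z} → IsSubeigenvector A z →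
                              ∀ i → tropComb ℝ A z i ≡ z i
    tropComb-fixesSubeigenvector (diag , _) {z} sub i = antisym
      (maxF-lub _ (sub i))
      (subst₂ _≤_ (trans (cong (z i +_) (diag i)) (+-identityʳ (z i))) refl (f≤maxF _ i))

    subeigenvector⇒inSpan : IsKleeneStar ℝ A → ∀ {z} → IsSubeigenvector A z →
                            InSpan ℝ A (dehomogenise z)
    subeigenvector⇒inSpan ks sub =
      _ , λ i → sym (cong₂ (_-_ ℝ) (tropComb-fixesSubeigenvector ks sub (inject₁ i))
                                   (tropComb-fixesSubeigenvector ks sub (fromℕ m)))

    inSpan⇒subeigenvector : IsKleeneStar ℝ A → ∀ {x} → InSpan ℝ A x →
                            ∃ λ z → IsSubeigenvector A z × x ≗ dehomogenise z
    inSpan⇒subeigenvector ks (lam , x≡) = tropComb ℝ A lam , tropComb-isSubeigenvector ks lam , x≡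

    isSubeigenvector-unshift : ∀ {c z} d → (∀ k → c k ≡ z k + d) →
                               IsSubeigenvector A c → IsSubeigenvector A z
    isSubeigenvector-unshift {c} {z} d c≡z+d sub i j =
      +-cancelʳ-≤ d (subst₂ _≤_ shift-out (c≡z+d i) (sub i j))
      where
      open ≡-Reasoning
      shift-out : c j + A i j ≡ (z j + A i j) + d
      shift-out = begin
        c j + A i j       ≡⟨ cong (_+ A i j) (c≡z+d j) ⟩
        (z j + d) + A i j ≡⟨ xy∙z≈xz∙y (z j) d (A i j) ⟩
        (z j + A i j) + d ∎

  dehomogenise-≗⇒shift : ∀ {m} {c z : Fin (suc m) → Carrier} →
                         dehomogenise c ≗ dehomogenise z →
                         ∀ k → c k ≡ z k + (- z (fromℕ m) + c (fromℕ m))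
  dehomogenise-≗⇒shift {m} {c} {z} c≗z k with view k
  ... | ‵fromℕ     = sym (\\-leftDividesˡ (z (fromℕ m)) (c (fromℕ m)))
  ... | ‵inject₁ i = begin
    c (inject₁ i)                                 ≡⟨ //-rightDividesˡ (c (fromℕ m)) _ ⟨
    dehomogenise c i + c (fromℕ m)                ≡⟨ cong (_+ c (fromℕ m)) (c≗z i) ⟩
    (z (inject₁ i) + - z (fromℕ m)) + c (fromℕ m) ≡⟨ +-assoc _ _ _ ⟩
    z (inject₁ i) + (- z (fromℕ m) + c (fromℕ m)) ∎
    where open ≡-Reasoning

  module _ {m} {A : Matrix ℝ (suc m)} (ks : IsKleeneStar ℝ A) where

    inSpan-dehomogenise⇒subeigenvector : ∀ {z} → InSpan ℝ A (dehomogenise z) →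
                                         IsSubeigenvector A z
    inSpan-dehomogenise⇒subeigenvector {z} z∈span with inSpan⇒subeigenvector ks z∈span
    ... | c , sub , z≗c = isSubeigenvector-unshift _ (dehomogenise-≗⇒shift (sym ∘ z≗c)) sub

    transpose-subeigenvector⇒inSpan-antipode : ∀ {c} → IsSubeigenvector (transpose ℝ A) c →
                                               InSpan ℝ A (antipode ℝ (dehomogenise c))
    transpose-subeigenvector⇒inSpan-antipode {c} sub =
      inSpan-resp A (λ i → ⁻¹-∙-comm (c (inject₁ i)) (- c (fromℕ m)))
        (subeigenvector⇒inSpan ks {λ k → - c k} λ i j → a+x≤b⇒-b+x≤-a (sub j i))

    inSpan-transpose⇒inSpan-antipode : ∀ {x} → InSpan ℝ (transpose ℝ A) x →
                                       InSpan ℝ A (antipode ℝ x)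
    inSpan-transpose⇒inSpan-antipode x∈span with inSpan⇒subeigenvector (transpose-isKleeneStar ks) x∈span
    ... | c , sub , x≗c =
      inSpan-resp A (λ i → cong -_ (sym (x≗c i))) (transpose-subeigenvector⇒inSpan-antipode sub)

    isSymmetric⇒spanSymmetric : IsSymmetric ℝ A → SpanSymmetric ℝ A
    isSymmetric⇒spanSymmetric sym-A x x∈span with inSpan⇒subeigenvector ks x∈span
    ... | z , sub , x≗z = inSpan-resp A (λ i → cong -_ (sym (x≗z i)))
      (transpose-subeigenvector⇒inSpan-antipode λ i j →
        subst₂ _≤_ (cong (z j +_) (sym-A i j)) refl (sub i j))

    spanSymmetric⇒isSymmetric : SpanSymmetric ℝ A → IsSymmetric ℝ A
    spanSymmetric⇒isSymmetric span-sym i j = antisym (below i j) (below j i)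
      where
      below : ∀ i j → A i j ≤ A j i
      below i j =
        subst₂ _≤_ (trans (cong (_+ A i j) (proj₁ ks j)) (+-identityˡ (A i j))) refl (row-sub i j)
        where
        row : Fin (suc m) → Carrier
        row k = A j k
        antipode-row∈span : InSpan ℝ A (antipode ℝ (dehomogenise row))
        antipode-row∈span = transpose-subeigenvector⇒inSpan-antipode
                      (column-isSubeigenvector (transpose-isKleeneStar ks) j)
        row-sub : IsSubeigenvector A row
        row-sub = inSpan-dehomogenise⇒subeigenvector
          (inSpan-resp A (antipode-involutive _) (span-sym _ antipode-row∈span))

  inSpan-transpose⇔antipode-inSpan :
    ∀ {m} {A : Matrix ℝ (suc m)} → IsKleeneStar ℝ A → ∀ x →
    InSpan ℝ (transpose ℝ A) x ⇔ (∃ λ y → InSpan ℝ A y × (∀ i → x i ≡ antipode ℝ y i))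
  inSpan-transpose⇔antipode-inSpan {A = A} ks x = mk⇔
    (λ x∈span → antipode ℝ x , inSpan-transpose⇒inSpan-antipode ks x∈span ,
                λ i → sym (antipode-involutive x i))
    (λ { (y , y∈span , x≡-y) → inSpan-resp (transpose ℝ A) (λ i → sym (x≡-y i))
           (inSpan-transpose⇒inSpan-antipode {A = transpose ℝ A} (transpose-isKleeneStar ks) y∈span) })

open KleeneStarSpan

mainTheorem3 : (ℝ : RealField) (m : ℕ) (A : Matrix ℝ (suc m)) →
    (IsKleeneStar ℝ A ⇔ IsKleeneStar ℝ (transpose ℝ A))
    × (IsKleeneStar ℝ A →
        ∀ (x : Fin m → RealField.Carrier ℝ) →
          InSpan ℝ (transpose ℝ A) x ⇔
            (∃ λ y → InSpan ℝ A y × (∀ i → x i ≡ antipode ℝ y i)))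
    × (IsKleeneStar ℝ A → (IsSymmetric ℝ A ⇔ SpanSymmetric ℝ A))
mainTheorem3 ℝ _ _ =
  mk⇔ (transpose-isKleeneStar ℝ) (transpose-isKleeneStar ℝ) ,
  inSpan-transpose⇔antipode-inSpan ℝ ,
  λ ks → mk⇔ (isSymmetric⇒spanSymmetric ℝ ks) (spanSymmetric⇒isSymmetric ℝ ks)
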